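{- Let $\mathbf{a}$ be a pure composition and let $(\alpha_1,\dots,\alpha_m)$ be a pure decomposition of $\mathbf{a}$. Then $\mathcal{P}(\mathbb{D}(\mathbf{a}))\cong\mathcal{P}(\mathbb{D}(\alpha_1))\times\cdots\times\mathcal{P}(\mathbb{D}(\alpha_m))$ as posets, where the product carries the componentwise order.
   Context: A diagram is a finite set of cells in $\mathbb{Z}_{>0}\times\mathbb{Z}_{>0}$; a cell $(r,c)$ lies in row $r$ (rows numbered from the bottom, starting at $1$) and column $c$. For a weak composition $\mathbf{b}=(b_1,\dots,b_k)$ (sequence of nonnegative integers), $\mathbb{D}(\mathbf{b})=\bigcup_{i=1}^k\{(i,j)\mid 1\le j\le b_i\}$. Applying a Kohnert move at row $r$ of a diagram $D$: if row $r$ is nonempty, let $(r,c)$ be its rightmost cell; if there is $r'$ with $1\le r'<r$ and $(r',c)\notin D$, take the largest such $r'$ and replace $(r,c)$ by $(r',c)$; otherwise $D$ is unchanged. The Kohnert poset $\mathcal{P}(D)$ is the set of diagrams obtainable from $D$ by finite (possibly empty) sequences of Kohnert moves, with $D_2\preceq D_1$ iff $D_2$ can be obtained from $D_1$ by Kohnert moves. A weak composition $\mathbf{a}=(a_1,\dots,a_n)$ is pure if there are no $1\le j_1<j_2<j_3\le n$ with $a_{j_1}<a_{j_2}<a_{j_3}$, or $a_{j_1}<a_{j_3}<a_{j_2}$, or $a_{j_1}+1<a_{j_2}=a_{j_3}$. A weak composition $\mathbf{b}=(b_1,\dots,b_k)$ is a basic pure composition if it is of one of the forms: (i) $b_1\ge\cdots\ge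 b_k$; (ii) there is $p\in\mathbb{Z}_{\ge0}$ with $b_1=p$ and $\{b_1,\dots,b_k\}=\{p,p+1\}$; (iii) $b_1\ge\cdots\ge b_{k-1}$ and $b_{k-1}<b_k-1$; (iv) there are $p\in\mathbb{Z}_{\ge0}$ and $t$ with $2<t<k$ such that $b_1=p$, $\{b_1,\dots,b_{t-1}\}=\{p,p+1\}$, $p>b_t\ge\cdots\ge b_{k-1}$, and $b_k=p+1$. For a weak composition $\alpha$, $\max(\alpha)$ and $\min(\alpha)$ are its largest and smallest entries. A pure decomposition of $\mathbf{a}$ is a sequence $(\alpha_1,\dots,\alpha_m)$ of basic pure compositions whose concatenation is $\mathbf{a}$ (i.e. $\alpha_j=(a_{i_j},\dots,a_{i_{j+1}-1})$ for indices $1=i_1<\cdots<i_m\le n=i_{m+1}-1$) such that $\min(\alpha_{j-1})\ge\max(\alpha_j)$ for $1<j\le m$. -}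

module Defs where

open import Data.Nat using (ℕ; zero; suc; _+_; _≤_; _<_; _≥_; _>_; _⊔_; _⊓_; _≡ᵇ_; _≤ᵇ_; _∸_)
open import Data.Bool using (Bool; true; false; _∧_; if_then_else_)
open import Data.List using (List; []; _∷_; length; concat; foldr)
open import Data.List.Relation.Unary.All using (All)
open import Data.List.Relation.Unary.Linked using (Linked)
open import Data.Product using (Σ; ∃; ∃-syntax; _×_; _,_)
open import Data.Sum using (_⊎_)
open import Data.Unit using (⊤; tt)
open import Data.Empty using (⊥)
open import Relation.Nullary using (¬_)
open import Relation.Binary.PropositionalEquality using (_≡_)

-- Weak compositions are lists of naturals; entries are indexed 1-based.

WeakComp : Set
WeakComp = List ℕ

-- at b i = b_i for 1 ≤ i ≤ length b (value 0 outside; never used there).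
at : WeakComp → ℕ → ℕ
at []       _             = 0
at (x ∷ xs) zero          = 0
at (x ∷ xs) (suc zero)    = x
at (x ∷ xs) (suc (suc i)) = at xs (suc i)

-- Diagrams: a diagram is given by its membership function
-- D r c = true  iff  the cell (r , c) (row r, column c) belongs to D.
-- Diagrams are compared pointwise (set equality).

Diagram : Set
Diagram = ℕ → ℕ → Bool

_≐_ : Diagram → Diagram → Set
D ≐ E = ∀ r c → D r c ≡ E r c

𝔻 : WeakComp → Diagram
𝔻 b i j = (1 ≤ᵇ i) ∧ (i ≤ᵇ length b) ∧ (1 ≤ᵇ j) ∧ (j ≤ᵇ at b i)

moveCell : Diagram → ℕ → ℕ → ℕ → Diagram
moveCell D r c r' i j =
  if (i ≡ᵇ r) ∧ (j ≡ᵇ c) then false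
  else if (i ≡ᵇ r') ∧ (j ≡ᵇ c) then true
  else D i j

-- A (non-trivial) Kohnert move at row r sending D to E:
-- (r , c) is the rightmost cell of row r, r' is the largest row index
-- with 1 ≤ r' < r and (r' , c) ∉ D, and E is D with (r , c) replaced
-- by (r' , c).  (Kohnert moves that leave D unchanged are covered by
-- reflexivity of the closure below.)
KohnertMove : Diagram → Diagram → Set
KohnertMove D E =
  ∃[ r ] ∃[ c ] ∃[ r' ]
    ( D r c ≡ true
    × (∀ c' → c < c' → D r c' ≡ false)
    × 1 ≤ r' × r' < r × D r' c ≡ false
    × (∀ r'' → r' < r'' → r'' < r → D r'' c ≡ true)
    × E ≐ moveCell D r c r' )

data Reach : Diagram → Diagram → Set where
  done : ∀ {D₁ D₂} → D₂ ≐ D₁ → Reach D₁ D₂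
  step : ∀ {D₁ D D₂} → KohnertMove D₁ D → Reach D D₂ → Reach D₁ D₂

record PosetData : Set₁ where
  field
    Carrier : Set
    _≈ₚ_    : Carrier → Carrier → Set
    _≤ₚ_    : Carrier → Carrier → Set

record _≅ₚ_ (P Q : PosetData) : Set where
  private
    module P = PosetData P
    module Q = PosetData Q
  field
    to         : P.Carrier → Q.Carrier
    from       : Q.Carrier → P.Carrier
    to-cong    : ∀ {x y} → x P.≈ₚ y → to x Q.≈ₚ to y
    from-cong  : ∀ {x y} → x Q.≈ₚ y → from x P.≈ₚ from y
    from∘to    : ∀ x → from (to x) P.≈ₚ x
    to∘from    : ∀ y → to (from y) Q.≈ₚ y
    to-mono    : ∀ {x y} → x P.≤ₚ y → to x Q.≤ₚ to y
    to-reflect : ∀ {x y} → to x Q.≤ₚ to y → x P.≤ₚ y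

𝒫 : Diagram → PosetData
𝒫 D = record
  { Carrier = Σ Diagram (Reach D)
  ; _≈ₚ_    = λ { (D₁ , _) (D₂ , _) → D₁ ≐ D₂ }
  ; _≤ₚ_    = λ { (D₂ , _) (D₁ , _) → Reach D₁ D₂ }
  }

_×ₚ_ : PosetData → PosetData → PosetData
P ×ₚ Q = record
  { Carrier = P.Carrier × Q.Carrier
  ; _≈ₚ_    = λ { (x , y) (x' , y') → (x P.≈ₚ x') × (y Q.≈ₚ y') }
  ; _≤ₚ_    = λ { (x , y) (x' , y') → (x P.≤ₚ x') × (y Q.≤ₚ y') }
  }
  where
    module P = PosetData P
    module Q = PosetData Q

𝟙ₚ : PosetData
𝟙ₚ = record { Carrier = ⊤ ; _≈ₚ_ = λ _ _ → ⊤ ; _≤ₚ_ = λ _ _ → ⊤ }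

ΠKohnert : List WeakComp → PosetData
ΠKohnert []       = 𝟙ₚ
ΠKohnert (α ∷ αs) = 𝒫 (𝔻 α) ×ₚ ΠKohnert αs

Pure : WeakComp → Set
Pure a =
  ∀ j₁ j₂ j₃ → 1 ≤ j₁ → j₁ < j₂ → j₂ < j₃ → j₃ ≤ length a →
    ¬ ( (at a j₁ < at a j₂ × at a j₂ < at a j₃)
      ⊎ (at a j₁ < at a j₃ × at a j₃ < at a j₂)
      ⊎ (at a j₁ + 1 < at a j₂ × at a j₂ ≡ at a j₃) )

DecreasingOn : WeakComp → ℕ → ℕ → Set
DecreasingOn b l u = ∀ i → l ≤ i → i < u → at b i ≥ at b (suc i)

ValuesAre : WeakComp → ℕ → ℕ → Set
ValuesAre b u p =
    (∀ i → 1 ≤ i → i ≤ u → at b i ≡ p ⊎ at b i ≡ suc p)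
  × (∃[ i ] (1 ≤ i × i ≤ u × at b i ≡ p))
  × (∃[ i ] (1 ≤ i × i ≤ u × at b i ≡ suc p))

BasicPure : WeakComp → Set
BasicPure b =
    DecreasingOn b 1 k
  ⊎ (∃[ p ] (at b 1 ≡ p × ValuesAre b k p))
  -- (iii)  (b_{k-1} < b_k - 1  written as  b_{k-1} + 1 < b_k)
  ⊎ (2 ≤ k × DecreasingOn b 1 (k ∸ 1)
           × at b (k ∸ 1) + 1 < at b k)
  ⊎ (∃[ p ] ∃[ t ] ( 2 < t × t < k × at b 1 ≡ p
                   × ValuesAre b (t ∸ 1) p
                   × p > at b t
                   × DecreasingOn b t (k ∸ 1)
                   × at b k ≡ suc p ))
  where k = length b

maxC : WeakComp → ℕ
maxC = foldr _⊔_ 0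

minC : WeakComp → ℕ
minC []       = 0
minC (x ∷ xs) = foldr _⊓_ x xs

NonEmpty : WeakComp → Set
NonEmpty []      = ⊥
NonEmpty (_ ∷ _) = ⊤

PureDecomposition : WeakComp → List WeakComp → Set
PureDecomposition a αs =
    concat αs ≡ a
  × All NonEmpty αs
  × All BasicPure αs
  × Linked (λ α β → minC α ≥ maxC β) αs

-- Only the condition min(αⱼ₋₁) ≥ max(αⱼ) of a pure decomposition is needed.  Cut 𝔻(α ++ β) at height k = length α.  If
-- max β ≤ min α, the rows 1..k are full in the columns 1..min α, and every cell
-- above row k lies in these columns.  This is preserved by Kohnert moves, and it
-- forces every move to act inside one of the two parts, leaving the other one
-- unchanged.  Hence X ↦ (lower part of X, upper part of X) is an isomorphism
-- 𝒫(𝔻(α ++ β)) ≅ 𝒫(𝔻 α) × 𝒫(𝔻 β), with inverse given by stacking, and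
-- induction over the decomposition gives the product.
module Submission where

open import Defs
open import Data.Bool using (true; false; if_then_else_)
open import Data.Bool.Properties using (T-≡; T-∧; ¬-not; ∧-zeroʳ)
open import Data.Empty using (⊥-elim)
open import Data.List using (List; []; _∷_; _++_; concat; length)
open import Data.List.Properties using (length-++; length-++-≤ˡ)
open import Data.List.Relation.Unary.Linked using (Linked; _∷_)
import Data.List.Relation.Unary.Linked as Linked
open import Data.Nat using (ℕ; zero; suc; _+_; _∸_; _≤_; _<_; _≥_; _⊔_; _≡ᵇ_; _≤ᵇ_; z≤n; s≤s; z<s)
open import Data.Nat.Properties
open import Data.Product using (_×_; _,_; proj₁; proj₂)
open import Data.Product.Relation.Binary.Pointwise.NonDependent using (×-isEquivalence)
open import Data.Sum using (_⊎_; inj₁; inj₂)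
open import Data.Unit using (tt)
open import Function using (_∘_)
open import Function.Bundles using (Equivalence)
open import Relation.Nullary using (yes; no)
open import Relation.Binary.Structures using (IsEquivalence)
open import Relation.Binary.PropositionalEquality using (_≡_; _≢_; refl; sym; trans; cong; subst)

open Equivalence using (to; from)

true≢false : true ≢ false
true≢false ()

≤⇒≤ᵇ≡true : ∀ {m n} → m ≤ n → (m ≤ᵇ n) ≡ true
≤⇒≤ᵇ≡true = to T-≡ ∘ ≤⇒≤ᵇ

≤ᵇ≡true⇒≤ : ∀ {m n} → (m ≤ᵇ n) ≡ true → m ≤ n
≤ᵇ≡true⇒≤ {m} {n} = ≤ᵇ⇒≤ m n ∘ from T-≡

>⇒≤ᵇ≡false : ∀ {m n} → n < m → (m ≤ᵇ n) ≡ false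
>⇒≤ᵇ≡false n<m = ¬-not (<⇒≱ n<m ∘ ≤ᵇ≡true⇒≤)

≡ᵇ-refl : ∀ m → (m ≡ᵇ m) ≡ true
≡ᵇ-refl m = to T-≡ (≡⇒≡ᵇ m m refl)

≢⇒≡ᵇ≡false : ∀ {m n} → m ≢ n → (m ≡ᵇ n) ≡ false
≢⇒≡ᵇ≡false {m} {n} m≢n = ¬-not (m≢n ∘ ≡ᵇ⇒≡ m n ∘ from T-≡)

+-cancelˡ-≡ᵇ : ∀ k m n → (k + m ≡ᵇ k + n) ≡ (m ≡ᵇ n)
+-cancelˡ-≡ᵇ zero    m n = refl
+-cancelˡ-≡ᵇ (suc k) m n = +-cancelˡ-≡ᵇ k m n

+-cancelˡ-≤ᵇ : ∀ k m n → (k + m ≤ᵇ k + n) ≡ (m ≤ᵇ n)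
+-cancelˡ-≤ᵇ k m n with m ≤? n
... | yes m≤n = trans (≤⇒≤ᵇ≡true (+-monoʳ-≤ k m≤n)) (sym (≤⇒≤ᵇ≡true m≤n))
... | no  m≰n = trans (>⇒≤ᵇ≡false (+-monoʳ-< k (≰⇒> m≰n))) (sym (>⇒≤ᵇ≡false (≰⇒> m≰n)))

≐-refl : ∀ {D} → D ≐ D
≐-refl r c = refl

≐-sym : ∀ {D E} → D ≐ E → E ≐ D
≐-sym D≐E r c = sym (D≐E r c)

≐-trans : ∀ {D E F} → D ≐ E → E ≐ F → D ≐ F
≐-trans D≐E E≐F r c = trans (D≐E r c) (E≐F r c)

moveCell-cong : ∀ D D' r c r' i j → D i j ≡ D' i j →
                moveCell D r c r' i j ≡ moveCell D' r c r' i j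
moveCell-cong D D' r c r' i j eq rewrite eq = refl

moveCell-otherRow : ∀ D r c r' i j → i ≢ r → i ≢ r' → moveCell D r c r' i j ≡ D i j
moveCell-otherRow D r c r' i j i≢r i≢r' rewrite ≢⇒≡ᵇ≡false i≢r | ≢⇒≡ᵇ≡false i≢r' = refl

moveCell-otherColumn : ∀ D r c r' i j → j ≢ c → moveCell D r c r' i j ≡ D i j
moveCell-otherColumn D r c r' i j j≢c
  rewrite ≢⇒≡ᵇ≡false j≢c | ∧-zeroʳ (i ≡ᵇ r) | ∧-zeroʳ (i ≡ᵇ r') = refl

moveCell-source : ∀ D r c r' → moveCell D r c r' r c ≡ false
moveCell-source D r c r' rewrite ≡ᵇ-refl r | ≡ᵇ-refl c = refl

moveCell-target : ∀ D r c r' → r' ≢ r → moveCell D r c r' r' c ≡ true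
moveCell-target D r c r' r'≢r rewrite ≢⇒≡ᵇ≡false r'≢r | ≡ᵇ-refl r' | ≡ᵇ-refl c = refl

moveCell-shift : ∀ D k r c r' i j →
  moveCell D (k + r) c (k + r') (k + i) j ≡ moveCell (λ i j → D (k + i) j) r c r' i j
moveCell-shift D k r c r' i j rewrite +-cancelˡ-≡ᵇ k i r | +-cancelˡ-≡ᵇ k i r' = refl

data MoveCellView (D : Diagram) (r c r' i j : ℕ) : Set where
  source : i ≡ r → j ≡ c → moveCell D r c r' i j ≡ false → MoveCellView D r c r' i j
  target : i ≡ r' → j ≡ c → moveCell D r c r' i j ≡ true → MoveCellView D r c r' i j
  other  : moveCell D r c r' i j ≡ D i j → MoveCellView D r c r' i j

moveCellView : ∀ D r c r' i j → r' ≢ r → MoveCellView D r c r' i j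
moveCellView D r c r' i j r'≢r with j ≟ c
... | no j≢c = other (moveCell-otherColumn D r c r' i j j≢c)
... | yes refl with i ≟ r
...   | yes refl = source refl refl (moveCell-source D r j r')
...   | no i≢r with i ≟ r'
...     | yes refl = target refl refl (moveCell-target D r j r' r'≢r)
...     | no i≢r' = other (moveCell-otherRow D r j r' i j i≢r i≢r')

-- KohnertMove D E is definitionally ∃[ r ] ∃[ c ] ∃[ r' ] MoveAt D E r c r'.
MoveAt : Diagram → Diagram → ℕ → ℕ → ℕ → Set
MoveAt D E r c r' =
    D r c ≡ true
  × (∀ c' → c < c' → D r c' ≡ false)
  × 1 ≤ r' × r' < r × D r' c ≡ false
  × (∀ r'' → r' < r'' → r'' < r → D r'' c ≡ true)
  × E ≐ moveCell D r c r'

KohnertMove-respˡ : ∀ {D E F} → D ≐ E → KohnertMove D F → KohnertMove E F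
KohnertMove-respˡ {D} {E} D≐E (r , c , r' , rc , right , 1≤r' , r'<r , r'c , between , F≐) =
  r , c , r' , trans (sym (D≐E r c)) rc , (λ c' c<c' → trans (sym (D≐E r c')) (right c' c<c')) ,
  1≤r' , r'<r , trans (sym (D≐E r' c)) r'c ,
  (λ r'' l u → trans (sym (D≐E r'' c)) (between r'' l u)) ,
  (λ i j → trans (F≐ i j) (moveCell-cong D E r c r' i j (D≐E i j)))

Reach-respˡ : ∀ {D E X} → D ≐ E → Reach D X → Reach E X
Reach-respˡ D≐E (done X≐D)      = done (≐-trans X≐D D≐E)
Reach-respˡ D≐E (step move rest) = step (KohnertMove-respˡ D≐E move) rest

Reach-respʳ : ∀ {D X Y} → X ≐ Y → Reach D X → Reach D Y
Reach-respʳ X≐Y (done X≐D)      = done (≐-trans (≐-sym X≐Y) X≐D)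
Reach-respʳ X≐Y (step move rest) = step move (Reach-respʳ X≐Y rest)

Reach-trans : ∀ {D E F} → Reach D E → Reach E F → Reach D F
Reach-trans (done E≐D)      E→F = Reach-respˡ E≐D E→F
Reach-trans (step move rest) E→F = step move (Reach-trans rest E→F)

Reach-preserves : (P : Diagram → Set) → (∀ {D E} → E ≐ D → P D → P E) →
  (∀ {D E r c r'} → P D → MoveAt D E r c r' → P E) →
  ∀ {D X} → P D → Reach D X → P X
Reach-preserves P resp move PD (done X≐D) = resp X≐D PD
Reach-preserves P resp move PD (step (r , c , r' , m) rest) =
  Reach-preserves P resp move (move PD m) rest

Reach-fromEmpty : ∀ {D X} → (∀ r c → D r c ≡ false) → Reach D X → X ≐ D
Reach-fromEmpty empty (done X≐D) = X≐D
Reach-fromEmpty empty (step (r , c , r' , rc , _) _) =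
  ⊥-elim (true≢false (trans (sym rc) (empty r c)))

module Stack (k : ℕ) where

  stack : Diagram → Diagram → Diagram
  stack A B i j = if i ≤ᵇ k then A i j else B (i ∸ k) j

  ∅ : Diagram
  ∅ _ _ = false

  lower : Diagram → Diagram
  lower D = stack D ∅

  upper : Diagram → Diagram
  upper D zero    j = false
  upper D (suc i) j = D (k + suc i) j

  data RowView : ℕ → Set where
    low  : ∀ {i} → i ≤ k → RowView i
    high : ∀ i → RowView (k + suc i)

  rowView : ∀ i → RowView i
  rowView i with i ≤? k
  ... | yes i≤k = low i≤k
  ... | no  i≰k with m≤n⇒∃[o]m+o≡n (≰⇒> i≰k)
  ...   | o , refl = subst RowView (+-suc k o) (high o)

  k<k+suc : ∀ i → k < k + suc i
  k<k+suc i = m<m+n k z<s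

  stack-low : ∀ A B {i} j → i ≤ k → stack A B i j ≡ A i j
  stack-low A B j i≤k rewrite ≤⇒≤ᵇ≡true i≤k = refl

  stack-high : ∀ A B i j → stack A B (k + suc i) j ≡ B (suc i) j
  stack-high A B i j rewrite >⇒≤ᵇ≡false (k<k+suc i) | m+n∸m≡n k (suc i) = refl

  stack-cong : ∀ {A A' B B'} → A ≐ A' → B ≐ B' → stack A B ≐ stack A' B'
  stack-cong A≐A' B≐B' i j rewrite A≐A' i j | B≐B' (i ∸ k) j = refl

  lower-cong : ∀ {D D'} → D ≐ D' → lower D ≐ lower D'
  lower-cong D≐D' = stack-cong {B = ∅} {B' = ∅} D≐D' ≐-refl

  upper-cong : ∀ {D D'} → D ≐ D' → upper D ≐ upper D'
  upper-cong D≐D' zero    j = refl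
  upper-cong D≐D' (suc i) j = D≐D' (k + suc i) j

  stack-lower-upper : ∀ D → stack (lower D) (upper D) ≐ D
  stack-lower-upper D i j with rowView i
  ... | low i≤k = trans (stack-low (lower D) (upper D) j i≤k) (stack-low D ∅ j i≤k)
  ... | high i' = stack-high (lower D) (upper D) i' j

  Below : Diagram → Set
  Below A = ∀ i j → A i j ≡ true → i ≤ k

  NoRowZero : Diagram → Set
  NoRowZero B = ∀ j → B 0 j ≡ false

  lower-below : ∀ D → Below (lower D)
  lower-below D i j cell with rowView i
  ... | low i≤k = i≤k
  ... | high i' = ⊥-elim (true≢false (trans (sym cell) (stack-high D ∅ i' j)))

  upper-noRowZero : ∀ D → NoRowZero (upper D)
  upper-noRowZero D j = refl

  lower-stack : ∀ {A B} → Below A → lower (stack A B) ≐ A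
  lower-stack {A} {B} below i j with rowView i
  ... | low i≤k = trans (stack-low (stack A B) ∅ j i≤k) (stack-low A B j i≤k)
  ... | high i' = trans (stack-high (stack A B) ∅ i' j)
                    (sym (¬-not (<⇒≱ (k<k+suc i') ∘ below (k + suc i') j)))

  upper-stack : ∀ {A B} → NoRowZero B → upper (stack A B) ≐ B
  upper-stack {A} {B} noRowZero zero    j = sym (noRowZero j)
  upper-stack {A} {B} noRowZero (suc i) j = stack-high A B i j

  Below-resp : ∀ {D E} → E ≐ D → Below D → Below E
  Below-resp E≐D below i j cell = below i j (trans (sym (E≐D i j)) cell)

  Below-move : ∀ {D E r c r'} → Below D → MoveAt D E r c r' → Below E
  Below-move {D} {E} {r} {c} {r'} below (rc , _ , _ , r'<r , _ , _ , E≐) i j cell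
    with moveCellView D r c r' i j (<⇒≢ r'<r)
  ... | source _ _ gone = ⊥-elim (true≢false (trans (sym cell) (trans (E≐ i j) gone)))
  ... | target refl _ _ = ≤-trans (<⇒≤ r'<r) (below r c rc)
  ... | other same = below i j (trans (sym same) (trans (sym (E≐ i j)) cell))

  NoRowZero-resp : ∀ {D E} → E ≐ D → NoRowZero D → NoRowZero E
  NoRowZero-resp E≐D noRowZero j = trans (E≐D 0 j) (noRowZero j)

  NoRowZero-move : ∀ {D E r c r'} → NoRowZero D → MoveAt D E r c r' → NoRowZero E
  NoRowZero-move {D} {E} {r} {c} {r'} noRowZero (_ , _ , 1≤r' , r'<r , _ , _ , E≐) j =
    trans (E≐ 0 j)
      (trans (moveCell-otherRow D r c r' 0 j (<⇒≢ (<-trans 1≤r' r'<r)) (<⇒≢ 1≤r')) (noRowZero j))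

  Below-reach : ∀ {D X} → Below D → Reach D X → Below X
  Below-reach = Reach-preserves Below Below-resp Below-move

  NoRowZero-reach : ∀ {D X} → NoRowZero D → Reach D X → NoRowZero X
  NoRowZero-reach = Reach-preserves NoRowZero NoRowZero-resp NoRowZero-move

  stack-moveˡ : ∀ A B r c r' → r ≤ k → r' ≤ k →
    stack (moveCell A r c r') B ≐ moveCell (stack A B) r c r'
  stack-moveˡ A B r c r' r≤k r'≤k i j with rowView i
  ... | low i≤k = trans (stack-low (moveCell A r c r') B j i≤k)
                    (moveCell-cong A (stack A B) r c r' i j (sym (stack-low A B j i≤k)))
  ... | high i' = trans (stack-high (moveCell A r c r') B i' j)
                    (sym (trans (moveCell-otherRow (stack A B) r c r' (k + suc i') j
                                   (>⇒≢ (≤-<-trans r≤k (k<k+suc i')))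
                                   (>⇒≢ (≤-<-trans r'≤k (k<k+suc i'))))
                                (stack-high A B i' j)))

  stack-moveʳ : ∀ A B r c r' → 1 ≤ r' → r' < r →
    stack A (moveCell B r c r') ≐ moveCell (stack A B) (k + r) c (k + r')
  stack-moveʳ A B r c r' 1≤r' r'<r i j with rowView i
  ... | low i≤k = trans (stack-low A (moveCell B r c r') j i≤k)
                    (sym (trans (moveCell-otherRow (stack A B) (k + r) c (k + r') i j
                                   (<⇒≢ (≤-<-trans i≤k (m<m+n k (<-trans 1≤r' r'<r))))
                                   (<⇒≢ (≤-<-trans i≤k (m<m+n k 1≤r'))))
                                (stack-low A B j i≤k)))
  ... | high i' = trans (stack-high A (moveCell B r c r') i' j)
                    (sym (trans (moveCell-shift (stack A B) k r c r' (suc i') j)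
                                (moveCell-cong (λ i j → stack A B (k + i) j) B r c r' (suc i') j
                                               (stack-high A B i' j))))

  MoveAt-stackˡ : ∀ A A' B r c r' → r ≤ k → MoveAt A A' r c r' →
    MoveAt (stack A B) (stack A' B) r c r'
  MoveAt-stackˡ A A' B r c r' r≤k (rc , right , 1≤r' , r'<r , r'c , between , A'≐) =
    trans (stack-low A B c r≤k) rc ,
    (λ c' c<c' → trans (stack-low A B c' r≤k) (right c' c<c')) ,
    1≤r' , r'<r ,
    trans (stack-low A B c r'≤k) r'c ,
    (λ r'' l u → trans (stack-low A B c (≤-trans (<⇒≤ u) r≤k)) (between r'' l u)) ,
    ≐-trans (stack-cong {B = B} {B' = B} A'≐ ≐-refl) (stack-moveˡ A B r c r' r≤k r'≤k)
    where r'≤k = ≤-trans (<⇒≤ r'<r) r≤k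

  MoveAt-stackʳ : ∀ A B B' r c r' → MoveAt B B' r c r' →
    MoveAt (stack A B) (stack A B') (k + r) c (k + r')
  MoveAt-stackʳ A B B' (suc r) c (suc r') (rc , right , 1≤r' , r'<r , r'c , between , B'≐) =
    trans (stack-high A B r c) rc ,
    (λ c' c<c' → trans (stack-high A B r c') (right c' c<c')) ,
    ≤-trans 1≤r' (m≤n+m (suc r') k) ,
    +-monoʳ-< k r'<r ,
    trans (stack-high A B r' c) r'c ,
    between' ,
    ≐-trans (stack-cong {A = A} {A' = A} ≐-refl B'≐) (stack-moveʳ A B (suc r) c (suc r') 1≤r' r'<r)
    where
      between' : ∀ r'' → k + suc r' < r'' → r'' < k + suc r → stack A B r'' c ≡ true
      between' r'' l u with rowView r''
      ... | low r''≤k = ⊥-elim (<⇒≱ (≤-<-trans (m≤m+n k (suc r')) l) r''≤k)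
      ... | high i = trans (stack-high A B i c)
                       (between (suc i) (+-cancelˡ-< k (suc r') (suc i) l)
                                        (+-cancelˡ-< k (suc i) (suc r) u))
  MoveAt-stackʳ A B B' r c zero (_ , _ , () , _)
  MoveAt-stackʳ A B B' zero c (suc r') (_ , _ , _ , () , _)

  Reach-stackˡ : ∀ {A A' B} → Below A → Reach A A' → Reach (stack A B) (stack A' B)
  Reach-stackˡ {B = B} below (done A'≐A) = done (stack-cong {B = B} {B' = B} A'≐A ≐-refl)
  Reach-stackˡ {A} {B = B} below (step {D = E} (r , c , r' , m) rest) =
    step (r , c , r' , MoveAt-stackˡ A E B r c r' (below r c (proj₁ m)) m)
         (Reach-stackˡ {B = B} (Below-move below m) rest)

  Reach-stackʳ : ∀ {A B B'} → Reach B B' → Reach (stack A B) (stack A B')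
  Reach-stackʳ {A} (done B'≐B) = done (stack-cong {A = A} {A' = A} ≐-refl B'≐B)
  Reach-stackʳ {A} {B} (step {D = E} (r , c , r' , m) rest) =
    step (k + r , c , k + r' , MoveAt-stackʳ A B E r c r' m) (Reach-stackʳ {A = A} rest)

  Reach-stack : ∀ {A A' B B'} → Below A → Reach A A' → Reach B B' →
                Reach (stack A B) (stack A' B')
  Reach-stack {A' = A'} {B} below A→A' B→B' =
    Reach-trans (Reach-stackˡ {B = B} below A→A') (Reach-stackʳ {A = A'} B→B')

  -- The invariant keeping the parts apart: a cell above row k sits in a column
  -- whose rows 1..k are full, so it can never drop into the lower part.
  Separated : ℕ → Diagram → Set
  Separated m D = (∀ r c → 1 ≤ r → r ≤ k → 1 ≤ c → c ≤ m → D r c ≡ true)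
                × (∀ r c → k < r → D r c ≡ true → 1 ≤ c × c ≤ m)

  Separated-resp : ∀ {m D E} → E ≐ D → Separated m D → Separated m E
  Separated-resp E≐D (full , narrow) =
    (λ r c 1≤r r≤k 1≤c c≤m → trans (E≐D r c) (full r c 1≤r r≤k 1≤c c≤m)) ,
    (λ r c k<r cell → narrow r c k<r (trans (sym (E≐D r c)) cell))

  Separated-move : ∀ {m D E r c r'} → Separated m D → MoveAt D E r c r' → Separated m E
  Separated-move {m} {D} {E} {r} {c} {r'} (full , narrow) (rc , _ , 1≤r' , r'<r , r'c , _ , E≐) =
    full' , narrow'
    where
      full' : ∀ r₀ c₀ → 1 ≤ r₀ → r₀ ≤ k → 1 ≤ c₀ → c₀ ≤ m → E r₀ c₀ ≡ true
      full' r₀ c₀ 1≤r₀ r₀≤k 1≤c₀ c₀≤m with moveCellView D r c r' r₀ c₀ (<⇒≢ r'<r)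
      ... | source refl refl _ =
            let r'≤k = ≤-trans (<⇒≤ r'<r) r₀≤k in
            ⊥-elim (true≢false (trans (sym (full r' c 1≤r' r'≤k 1≤c₀ c₀≤m)) r'c))
      ... | target _ _ moved = trans (E≐ r₀ c₀) moved
      ... | other same = trans (E≐ r₀ c₀) (trans same (full r₀ c₀ 1≤r₀ r₀≤k 1≤c₀ c₀≤m))
      narrow' : ∀ r₀ c₀ → k < r₀ → E r₀ c₀ ≡ true → 1 ≤ c₀ × c₀ ≤ m
      narrow' r₀ c₀ k<r₀ cell with moveCellView D r c r' r₀ c₀ (<⇒≢ r'<r)
      ... | source _ _ gone = ⊥-elim (true≢false (trans (sym cell) (trans (E≐ r₀ c₀) gone)))
      ... | target refl refl _ = narrow r c (<-trans k<r₀ r'<r) rc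
      ... | other same = narrow r₀ c₀ k<r₀ (trans (sym same) (trans (sym (E≐ r₀ c₀)) cell))

  Separated-reach : ∀ {m D X} → Separated m D → Reach D X → Separated m X
  Separated-reach {m} = Reach-preserves (Separated m) Separated-resp Separated-move

  LowerMove : Diagram → Diagram → Set
  LowerMove D E = KohnertMove (lower D) (lower E) × upper E ≐ upper D

  UpperMove : Diagram → Diagram → Set
  UpperMove D E = lower E ≐ lower D × KohnertMove (upper D) (upper E)

  lowMove⇒LowerMove : ∀ D E r c r' → r ≤ k → MoveAt D E r c r' → LowerMove D E
  lowMove⇒LowerMove D E r c r' r≤k m@(_ , _ , _ , r'<r , _ , _ , E≐) =
    (r , c , r' , MoveAt-stackˡ D E ∅ r c r' r≤k m) , upper≐
    where
      upper≐ : upper E ≐ upper D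
      upper≐ zero    j = refl
      upper≐ (suc i) j = trans (E≐ (k + suc i) j)
        (moveCell-otherRow D r c r' (k + suc i) j
           (>⇒≢ (≤-<-trans r≤k (k<k+suc i))) (>⇒≢ (≤-<-trans (≤-trans (<⇒≤ r'<r) r≤k) (k<k+suc i))))

  highMove⇒UpperMove : ∀ D E r c r' → MoveAt D E (k + suc r) c (k + suc r') → UpperMove D E
  highMove⇒UpperMove D E r c r' (rc , right , _ , r'<r , r'c , between , E≐) =
    lower≐ , (suc r , c , suc r' , rc , right , z<s , +-cancelˡ-< k (suc r') (suc r) r'<r ,
              r'c , between' , upper≐)
    where
      lower≐ : lower E ≐ lower D
      lower≐ i j with rowView i
      ... | low i≤k = trans (stack-low E ∅ j i≤k)
                        (trans (trans (E≐ i j)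
                                      (moveCell-otherRow D (k + suc r) c (k + suc r') i j
                                         (<⇒≢ (≤-<-trans i≤k (k<k+suc r)))
                                         (<⇒≢ (≤-<-trans i≤k (k<k+suc r')))))
                               (sym (stack-low D ∅ j i≤k)))
      ... | high i' = trans (stack-high E ∅ i' j) (sym (stack-high D ∅ i' j))
      between' : ∀ r'' → suc r' < r'' → r'' < suc r → upper D r'' c ≡ true
      between' (suc r'') l u = between (k + suc r'') (+-monoʳ-< k l) (+-monoʳ-< k u)
      upper≐ : upper E ≐ moveCell (upper D) (suc r) c (suc r')
      upper≐ zero    j = sym (moveCell-otherRow (upper D) (suc r) c (suc r') 0 j (λ ()) (λ ()))
      upper≐ (suc i) j = trans (E≐ (k + suc i) j) (moveCell-shift D k (suc r) c (suc r') (suc i) j)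

  MoveAt-split : ∀ {m D E r c r'} → Separated m D → RowView r → RowView r' →
    MoveAt D E r c r' → LowerMove D E ⊎ UpperMove D E
  MoveAt-split {D = D} {E} {r} {c} {r'} _ (low r≤k) _ m = inj₁ (lowMove⇒LowerMove D E r c r' r≤k m)
  MoveAt-split {D = D} {E} {c = c} _ (high i) (high i') m = inj₂ (highMove⇒UpperMove D E i c i' m)
  MoveAt-split {c = c} (full , narrow) (high i) (low r'≤k) (rc , _ , 1≤r' , _ , r'c , _)
    with narrow (k + suc i) c (k<k+suc i) rc
  ... | 1≤c , c≤m = ⊥-elim (true≢false (trans (sym (full _ c 1≤r' r'≤k 1≤c c≤m)) r'c))

  Reach-split : ∀ {m D X} → Separated m D → Reach D X →
                Reach (lower D) (lower X) × Reach (upper D) (upper X)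
  Reach-split sep (done X≐D) = done (lower-cong X≐D) , done (upper-cong X≐D)
  Reach-split sep (step (r , c , r' , m) rest)
    with MoveAt-split sep (rowView r) (rowView r') m | Reach-split (Separated-move sep m) rest
  ... | inj₁ (move , upper≐) | lowerReach , upperReach =
        step move lowerReach , Reach-respˡ upper≐ upperReach
  ... | inj₂ (lower≐ , move) | lowerReach , upperReach =
        Reach-respˡ lower≐ lowerReach , step move upperReach

  𝒫-split : ∀ {m D A B} → Separated m D → lower D ≐ A → upper D ≐ B →
            𝒫 D ≅ₚ (𝒫 A ×ₚ 𝒫 B)
  𝒫-split {D = D} {A} {B} sep lower≐ upper≐ = record
    { to         = λ { (X , D→X) → let lowerReach , upperReach = Reach-split sep D→X in
                       (lower X , Reach-respˡ lower≐ lowerReach) ,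
                       (upper X , Reach-respˡ upper≐ upperReach) }
    ; from       = λ { ((A' , A→A') , (B' , B→B')) → stack A' B' , D→stack A→A' B→B' }
    ; to-cong    = λ X≐Y → lower-cong X≐Y , upper-cong X≐Y
    ; from-cong  = λ { {(A₁ , _) , (B₁ , _)} {(A₂ , _) , (B₂ , _)} (A≐ , B≐) →
                       stack-cong {A₁} {A₂} {B₁} {B₂} A≐ B≐ }
    ; from∘to    = λ { (X , _) → stack-lower-upper X }
    ; to∘from    = λ { ((A' , A→A') , (B' , B→B')) →
                       lower-stack {A'} {B'} (Below-reach belowA A→A') ,
                       upper-stack {A'} {B'} (NoRowZero-reach noRowZeroB B→B') }
    ; to-mono    = λ { {_} {Y , D→Y} Y→X → Reach-split (Separated-reach sep D→Y) Y→X }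
    ; to-reflect = λ { {X , _} {Y , _} (lowerReach , upperReach) →
                       Reach-respʳ (stack-lower-upper X) (Reach-respˡ (stack-lower-upper Y)
                         (Reach-stack (lower-below Y) lowerReach upperReach)) }
    }
    where
      belowA : Below A
      belowA = Below-resp (≐-sym lower≐) (lower-below D)
      noRowZeroB : NoRowZero B
      noRowZeroB = NoRowZero-resp (≐-sym upper≐) (upper-noRowZero D)
      stackAB≐D : stack A B ≐ D
      stackAB≐D = ≐-trans (≐-sym (stack-cong {lower D} {A} {upper D} {B} lower≐ upper≐))
                          (stack-lower-upper D)
      D→stack : ∀ {A' B'} → Reach A A' → Reach B B' → Reach D (stack A' B')
      D→stack A→A' B→B' = Reach-respˡ stackAB≐D (Reach-stack belowA A→A' B→B')

≅ₚ-trans : ∀ {P Q R} → P ≅ₚ Q → Q ≅ₚ R →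
           IsEquivalence (PosetData._≈ₚ_ P) → IsEquivalence (PosetData._≈ₚ_ R) → P ≅ₚ R
≅ₚ-trans P≅Q Q≅R equivP equivR = record
  { to         = F.to ∘ E.to
  ; from       = E.from ∘ F.from
  ; to-cong    = F.to-cong ∘ E.to-cong
  ; from-cong  = E.from-cong ∘ F.from-cong
  ; from∘to    = λ x → IsEquivalence.trans equivP (E.from-cong (F.from∘to (E.to x))) (E.from∘to x)
  ; to∘from    = λ y → IsEquivalence.trans equivR (F.to-cong (E.to∘from (F.from y))) (F.to∘from y)
  ; to-mono    = F.to-mono ∘ E.to-mono
  ; to-reflect = E.to-reflect ∘ F.to-reflect
  }
  where
    module E = _≅ₚ_ P≅Q
    module F = _≅ₚ_ Q≅R

×ₚ-congʳ : ∀ {A Q R} → IsEquivalence (PosetData._≈ₚ_ A) → Q ≅ₚ R → (A ×ₚ Q) ≅ₚ (A ×ₚ R)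
×ₚ-congʳ equivA Q≅R = record
  { to         = λ { (a , q) → a , F.to q }
  ; from       = λ { (a , r) → a , F.from r }
  ; to-cong    = λ { (a≈ , q≈) → a≈ , F.to-cong q≈ }
  ; from-cong  = λ { (a≈ , r≈) → a≈ , F.from-cong r≈ }
  ; from∘to    = λ { (a , q) → IsEquivalence.refl equivA , F.from∘to q }
  ; to∘from    = λ { (a , r) → IsEquivalence.refl equivA , F.to∘from r }
  ; to-mono    = λ { (a≤ , q≤) → a≤ , F.to-mono q≤ }
  ; to-reflect = λ { (a≤ , r≤) → a≤ , F.to-reflect r≤ }
  }
  where module F = _≅ₚ_ Q≅R

𝒫-≈-isEquivalence : ∀ D → IsEquivalence (PosetData._≈ₚ_ (𝒫 D))
𝒫-≈-isEquivalence D = record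
  { refl  = ≐-refl
  ; sym   = ≐-sym
  ; trans = λ {X} {Y} {Z} → ≐-trans {proj₁ X} {proj₁ Y} {proj₁ Z}
  }

ΠKohnert-≈-isEquivalence : ∀ αs → IsEquivalence (PosetData._≈ₚ_ (ΠKohnert αs))
ΠKohnert-≈-isEquivalence []       = record { refl = tt ; sym = λ _ → tt ; trans = λ _ _ → tt }
ΠKohnert-≈-isEquivalence (α ∷ αs) =
  ×-isEquivalence (𝒫-≈-isEquivalence (𝔻 α)) (ΠKohnert-≈-isEquivalence αs)

at-zero : ∀ b → at b 0 ≡ 0
at-zero []      = refl
at-zero (_ ∷ _) = refl

at-++ˡ : ∀ α β i → i ≤ length α → at (α ++ β) i ≡ at α i
at-++ˡ []      β zero          _         = at-zero β
at-++ˡ (x ∷ α) β zero          _         = refl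
at-++ˡ (x ∷ α) β (suc zero)    _         = refl
at-++ˡ (x ∷ α) β (suc (suc i)) (s≤s i≤α) = at-++ˡ α β (suc i) i≤α

at-++ʳ : ∀ α β i → at (α ++ β) (length α + suc i) ≡ at β (suc i)
at-++ʳ []      β i = refl
at-++ʳ (x ∷ α) β i rewrite +-suc (length α) i =
  trans (cong (at (α ++ β)) (sym (+-suc (length α) i))) (at-++ʳ α β i)

maxC-++ : ∀ α β → maxC (α ++ β) ≡ maxC α ⊔ maxC β
maxC-++ []      β = refl
maxC-++ (x ∷ α) β = trans (cong (x ⊔_) (maxC-++ α β)) (sym (⊔-assoc x (maxC α) (maxC β)))

at≤maxC : ∀ b i → at b i ≤ maxC b
at≤maxC []      i             = z≤n
at≤maxC (x ∷ b) zero          = z≤n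
at≤maxC (x ∷ b) (suc zero)    = m≤m⊔n x (maxC b)
at≤maxC (x ∷ b) (suc (suc i)) = ≤-trans (at≤maxC b (suc i)) (m≤n⊔m x (maxC b))

minC≤head : ∀ x b → minC (x ∷ b) ≤ x
minC≤head x []      = ≤-refl
minC≤head x (y ∷ b) = ≤-trans (m⊓n≤n y (minC (x ∷ b))) (minC≤head x b)

-- minC (x ∷ y ∷ b) unfolds to y ⊓ minC (x ∷ b): the head x is compared last.
minC≤at : ∀ b i → 1 ≤ i → i ≤ length b → minC b ≤ at b i
minC≤at (x ∷ b)     (suc zero)          _ _                 = minC≤head x b
minC≤at (x ∷ [])    (suc (suc _))       _ (s≤s ())
minC≤at (x ∷ y ∷ b) (suc (suc zero))    _ _                 = m⊓n≤m y (minC (x ∷ b))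
minC≤at (x ∷ y ∷ b) (suc (suc (suc i))) _ (s≤s (s≤s i≤b)) =
  ≤-trans (m⊓n≤n y (minC (x ∷ b))) (minC≤at (x ∷ b) (suc (suc i)) z<s (s≤s i≤b))

minC≤maxC : ∀ b → minC b ≤ maxC b
minC≤maxC []      = z≤n
minC≤maxC (x ∷ b) = ≤-trans (minC≤head x b) (m≤m⊔n x (maxC b))

𝔻-cell⁻ : ∀ b i j → 𝔻 b i j ≡ true → 1 ≤ i × i ≤ length b × 1 ≤ j × j ≤ at b i
𝔻-cell⁻ b i j cell =
  let 1≤i , rest  = to T-∧ (from T-≡ cell)
      i≤b , rest' = to T-∧ rest
      1≤j , j≤bi  = to T-∧ rest'
  in ≤ᵇ⇒≤ 1 i 1≤i , ≤ᵇ⇒≤ i (length b) i≤b , ≤ᵇ⇒≤ 1 j 1≤j , ≤ᵇ⇒≤ j (at b i) j≤bi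

𝔻-cell⁺ : ∀ b i j → 1 ≤ i → i ≤ length b → 1 ≤ j → j ≤ at b i → 𝔻 b i j ≡ true
𝔻-cell⁺ b i j 1≤i i≤b 1≤j j≤bi
  rewrite ≤⇒≤ᵇ≡true 1≤i | ≤⇒≤ᵇ≡true i≤b | ≤⇒≤ᵇ≡true 1≤j | ≤⇒≤ᵇ≡true j≤bi = refl

𝔻[]-empty : ∀ i j → 𝔻 [] i j ≡ false
𝔻[]-empty zero    j = refl
𝔻[]-empty (suc i) j = refl

𝒫-𝔻[]≅𝟙 : 𝒫 (𝔻 []) ≅ₚ 𝟙ₚ
𝒫-𝔻[]≅𝟙 = record
  { to         = λ _ → tt
  ; from       = λ _ → 𝔻 [] , done ≐-refl
  ; to-cong    = λ _ → tt
  ; from-cong  = λ _ → ≐-refl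
  ; from∘to    = λ { (X , ∅→X) → ≐-sym (Reach-fromEmpty 𝔻[]-empty ∅→X) }
  ; to∘from    = λ _ → tt
  ; to-mono    = λ _ → tt
  ; to-reflect = λ { {X , ∅→X} {Y , ∅→Y} _ →
                     done (≐-trans (Reach-fromEmpty 𝔻[]-empty ∅→X)
                                   (≐-sym (Reach-fromEmpty 𝔻[]-empty ∅→Y))) }
  }

module _ (α β : WeakComp) where
  open Stack (length α)

  𝔻-++ : 𝔻 (α ++ β) ≐ stack (𝔻 α) (𝔻 β)
  𝔻-++ i j with rowView i
  ... | low i≤α = trans 𝔻-low (sym (stack-low (𝔻 α) (𝔻 β) j i≤α))
    where
      𝔻-low : 𝔻 (α ++ β) i j ≡ 𝔻 α i j
      𝔻-low rewrite at-++ˡ α β i i≤α | ≤⇒≤ᵇ≡true i≤α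
                  | ≤⇒≤ᵇ≡true (≤-trans i≤α (length-++-≤ˡ α {β})) = refl
  ... | high i' = trans 𝔻-high (sym (stack-high (𝔻 α) (𝔻 β) i' j))
    where
      𝔻-high : 𝔻 (α ++ β) (length α + suc i') j ≡ 𝔻 β (suc i') j
      𝔻-high rewrite at-++ʳ α β i' | length-++ α {β} | +-cancelˡ-≤ᵇ (length α) (suc i') (length β)
                   | ≤⇒≤ᵇ≡true {1} {length α + suc i'} (≤-trans z<s (m≤n+m (suc i') (length α))) = refl

  𝔻-below : Below (𝔻 α)
  𝔻-below i j cell = proj₁ (proj₂ (𝔻-cell⁻ α i j cell))

  𝔻-++-separated : maxC β ≤ minC α → Separated (minC α) (𝔻 (α ++ β))
  𝔻-++-separated β≤α = full , narrow
    where
      full : ∀ r c → 1 ≤ r → r ≤ length α → 1 ≤ c → c ≤ minC α → 𝔻 (α ++ β) r c ≡ true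
      full r c 1≤r r≤α 1≤c c≤α = trans (𝔻-++ r c) (trans (stack-low (𝔻 α) (𝔻 β) c r≤α)
        (𝔻-cell⁺ α r c 1≤r r≤α 1≤c (≤-trans c≤α (minC≤at α r 1≤r r≤α))))
      narrowAt : ∀ {r} c → RowView r → length α < r → 𝔻 (α ++ β) r c ≡ true → 1 ≤ c × c ≤ minC α
      narrowAt c (low r≤α) α<r _ = ⊥-elim (<⇒≱ α<r r≤α)
      narrowAt c (high i) _ cell =
        let _ , _ , 1≤c , c≤βᵢ = 𝔻-cell⁻ β (suc i) c
              (trans (sym (stack-high (𝔻 α) (𝔻 β) i c)) (trans (sym (𝔻-++ (length α + suc i) c)) cell))
        in 1≤c , ≤-trans c≤βᵢ (≤-trans (at≤maxC β (suc i)) β≤α)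
      narrow : ∀ r c → length α < r → 𝔻 (α ++ β) r c ≡ true → 1 ≤ c × c ≤ minC α
      narrow r c = narrowAt c (rowView r)

  𝒫-𝔻-++ : maxC β ≤ minC α → 𝒫 (𝔻 (α ++ β)) ≅ₚ (𝒫 (𝔻 α) ×ₚ 𝒫 (𝔻 β))
  𝒫-𝔻-++ β≤α = 𝒫-split (𝔻-++-separated β≤α)
    (≐-trans (lower-cong {𝔻 (α ++ β)} 𝔻-++) (lower-stack {𝔻 α} {𝔻 β} 𝔻-below))
    (≐-trans (upper-cong 𝔻-++) (upper-stack {𝔻 α} {𝔻 β} (λ _ → refl)))

_≽_ : WeakComp → WeakComp → Set
α ≽ β = minC α ≥ maxC β

maxC-concat≤minC : ∀ α αs → Linked _≽_ (α ∷ αs) → maxC (concat αs) ≤ minC α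
maxC-concat≤minC α []       _             = z≤n
maxC-concat≤minC α (β ∷ αs) (α≽β ∷ β≽αs) =
  subst (_≤ minC α) (sym (maxC-++ β (concat αs)))
    (⊔-lub α≽β (≤-trans (maxC-concat≤minC β αs β≽αs) (≤-trans (minC≤maxC β) α≽β)))

𝒫-𝔻-concat : ∀ αs → Linked _≽_ αs → 𝒫 (𝔻 (concat αs)) ≅ₚ ΠKohnert αs
𝒫-𝔻-concat []       _      = 𝒫-𝔻[]≅𝟙
𝒫-𝔻-concat (α ∷ αs) linked =
  ≅ₚ-trans (𝒫-𝔻-++ α (concat αs) (maxC-concat≤minC α αs linked))
           (×ₚ-congʳ (𝒫-≈-isEquivalence (𝔻 α)) (𝒫-𝔻-concat αs (Linked.tail linked)))
           (𝒫-≈-isEquivalence (𝔻 (concat (α ∷ αs)))) (ΠKohnert-≈-isEquivalence (α ∷ αs))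

proposition5p13 : (a : WeakComp) (αs : List WeakComp) →
    Pure a → PureDecomposition a αs →
    𝒫 (𝔻 a) ≅ₚ ΠKohnert αs
proposition5p13 .(concat αs) αs _ (refl , _ , _ , linked) = 𝒫-𝔻-concat αs linked
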